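{- Let $n$ be a positive integer and define $R_{2n+1}$ by: $R_3=\{0\}$; $R_5=\{0,1,2,3,5,7,13,26,27,28,29,31\}$; $R_7=\{0,1,2,3,4,5,7,10,33,34,35,36,37,38\}$; and for $n>3$, $R_{2n+1}=N\cup\{3n+1\}\cup\{x+2n^2+5n:x\in N\}$ with $N=\{0,1,\ldots,2n-1\}\cup\{2n+1\}$. Then for every $\alpha\in R_{2n+1}$ there exist $x_2,\ldots,x_{2n+1}\in R_{2n+1}$ such that $x_2,\ldots,x_{2n}$ are pairwise distinct and $\alpha+\sum_{k=2}^{2n}x_k=2n\,x_{2n+1}$. -}

module Defs where

open import Data.Nat using (ℕ; zero; suc; _+_; _*_; _<_; _^_)
open import Data.Fin using (Fin)
open import Data.List using (List; _∷_; [])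
open import Data.List.Membership.Propositional using (_∈_)
open import Data.Sum using (_⊎_)
open import Data.Product using (Σ; _×_)
open import Data.Empty using (⊥)
open import Relation.Binary.PropositionalEquality using (_≡_)

inN : ℕ → ℕ → Set
inN n x = (x < 2 * n) ⊎ (x ≡ 2 * n + 1)

-- Membership in R_{2n+1}, for positive n (R for n = 0 is empty; unused).
R : ℕ → ℕ → Set
R 0 x = ⊥
R 1 x = x ∈ (0 ∷ [])
R 2 x = x ∈ (0 ∷ 1 ∷ 2 ∷ 3 ∷ 5 ∷ 7 ∷ 13 ∷ 26 ∷ 27 ∷ 28 ∷ 29 ∷ 31 ∷ [])
R 3 x = x ∈ (0 ∷ 1 ∷ 2 ∷ 3 ∷ 4 ∷ 5 ∷ 7 ∷ 10 ∷ 33 ∷ 34 ∷ 35 ∷ 36 ∷ 37 ∷ 38 ∷ [])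
R n@(suc (suc (suc (suc _)))) x =
  inN n x ⊎ (x ≡ 3 * n + 1) ⊎ (Σ ℕ λ y → inN n y × (x ≡ y + (2 * n ^ 2 + 5 * n)))

sumFin : (m : ℕ) → (Fin m → ℕ) → ℕ
sumFin zero f = 0
sumFin (suc m) f = f Fin.zero + sumFin m (λ i → f (Fin.suc i))

module Submission where

-- Call α "balanced" in a set S of naturals (for k = 2n-1 summands)
-- if α + x₁ + ... + x_k = (k+1)·x with x₁, ..., x_k ∈ S pairwise distinct and
-- x ∈ S.  The whole proof rests on one observation: if S contains the block
-- d, d+1, ..., d+k of k+1 consecutive numbers, take for x₁, ..., x_k that block
-- with d + j omitted.  Their sum is (k+1)d + (0 + 1 + ... + k) - j, so d + y is
-- balanced as soon as  y + (0 + ... + k) = (k+1)x + j  with d + x in the block;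
-- that is, as soon as the quotient x of y + (0 + ... + k) by k+1 is at most k,
-- the remainder being j.  For k + 1 = 2n with n ≥ 2 this holds for all y < 4n.  For n ≥ 4 every
-- element of R_{2n+1} is d + y with y < 4n and d ∈ {0, 2n²+5n}, and both
-- blocks [0, 2n) and [2n²+5n, 2n²+7n) lie in R_{2n+1}; the sporadic sets
-- R_3, R_5, R_7 are handled by explicit, mechanically checked witnesses.

open import Defs
open import Data.Fin using (Fin; zero; suc; toℕ; punchIn)
open import Data.Fin.Properties using (toℕ<n; toℕ-injective; toℕ-fromℕ<; punchIn-injective; all?)
import Data.Fin.Properties as Fin
open import Data.List using (List; _∷_; [])
open import Data.List.Membership.Propositional using (_∈_)
open import Data.List.Relation.Unary.All as All using (All; _∷_; [])
open import Data.Nat using (ℕ; zero; suc; _+_; _*_; _^_; _<_; _≤_; z≤n; s≤s; z<s; _≟_)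
open import Data.List.Membership.DecPropositional _≟_ using (_∈?_)
open import Data.Nat.DivMod using (_/_; _%_; _mod_; m≡m%n+[m/n]*n; m<n*o⇒m/o<n)
open import Data.Nat.Properties
open import Algebra.Properties.CommutativeSemigroup +-commutativeSemigroup using (interchange; x∙yz≈y∙xz)
open import Data.Nat.Tactic.RingSolver using (solve-∀)
open import Data.Product using (Σ; _×_; _,_)
open import Data.Sum using (inj₁; inj₂)
open import Data.Vec using (Vec; lookup) renaming (_∷_ to _∷ᵥ_; [] to []ᵥ)
open import Function using (_∘_)
open import Function.Definitions using (Injective)
open import Relation.Binary.PropositionalEquality
open import Relation.Nullary.Decidable using (True; toWitness; _→-dec_)

Balanced : ℕ → (ℕ → Set) → ℕ → Set
Balanced k S α = Σ (Fin k → ℕ) λ xs → Σ ℕ λ xlast →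
  ((i : Fin k) → S (xs i)) × S xlast × Injective _≡_ _≡_ xs ×
  (α + sumFin k xs ≡ suc k * xlast)

sumFin-shift : ∀ k d (f : Fin k → ℕ) → sumFin k (λ i → d + f i) ≡ k * d + sumFin k f
sumFin-shift zero    d f = refl
sumFin-shift (suc k) d f = begin
  d + f zero + sumFin k (λ i → d + f (suc i))   ≡⟨ cong (d + f zero +_) (sumFin-shift k d (f ∘ suc)) ⟩
  d + f zero + (k * d + sumFin k (f ∘ suc))     ≡⟨ interchange d (f zero) (k * d) _ ⟩
  suc k * d + sumFin (suc k) f                  ∎
  where open ≡-Reasoning

sumFin-omit : ∀ {k} (f : Fin (suc k) → ℕ) (j : Fin (suc k)) →
              sumFin (suc k) f ≡ f j + sumFin k (f ∘ punchIn j)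
sumFin-omit             f zero    = refl
sumFin-omit {k = suc k} f (suc j) = begin
  f zero + sumFin (suc k) (f ∘ suc)                   ≡⟨ cong (f zero +_) (sumFin-omit (f ∘ suc) j) ⟩
  f zero + (f (suc j) + sumFin k (f ∘ suc ∘ punchIn j)) ≡⟨ x∙yz≈y∙xz (f zero) (f (suc j)) _ ⟩
  f (suc j) + sumFin (suc k) (f ∘ punchIn (suc j))    ∎
  where open ≡-Reasoning

gauss : ∀ k → 2 * sumFin (suc k) toℕ ≡ suc k * k
gauss zero    = refl
gauss (suc k) = begin
  2 * sumFin (suc k) (λ i → 1 + toℕ i)     ≡⟨ cong (2 *_) (sumFin-shift (suc k) 1 toℕ) ⟩
  2 * (suc k * 1 + sumFin (suc k) toℕ)      ≡⟨ *-distribˡ-+ 2 (suc k * 1) _ ⟩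
  2 * (suc k * 1) + 2 * sumFin (suc k) toℕ  ≡⟨ cong (2 * (suc k * 1) +_) (gauss k) ⟩
  2 * (suc k * 1) + suc k * k               ≡⟨ step k ⟩
  suc (suc k) * suc k                       ∎
  where
  open ≡-Reasoning
  step : ∀ k → 2 * (suc k * 1) + suc k * k ≡ suc (suc k) * suc k
  step = solve-∀

omission-balanced : ∀ k (S : ℕ → Set) (d y x : ℕ) (j : Fin (suc k)) →
  ((i : Fin (suc k)) → S (d + toℕ i)) → S (d + x) →
  y + sumFin (suc k) toℕ ≡ suc k * x + toℕ j →
  Balanced k S (d + y)
omission-balanced k S d y x j block last quotient =
  xs , d + x , (λ i → block (punchIn j i)) , last , xs-injective , balance
  where
  open ≡-Reasoning
  K = suc k
  T = sumFin K toℕ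

  xs : Fin k → ℕ
  xs i = d + toℕ (punchIn j i)

  xs-injective : Injective _≡_ _≡_ xs
  xs-injective e = punchIn-injective j _ _ (toℕ-injective (+-cancelˡ-≡ d _ _ e))

  block-sum : d + toℕ j + sumFin k xs ≡ K * d + T
  block-sum = trans (sym (sumFin-omit (λ i → d + toℕ i) j)) (sumFin-shift K d toℕ)

  regroup : ∀ d y s j → d + y + s + j ≡ y + (d + j + s)
  regroup = solve-∀

  balance : d + y + sumFin k xs ≡ K * (d + x)
  balance = +-cancelʳ-≡ (toℕ j) _ _ (begin
    d + y + sumFin k xs + toℕ j    ≡⟨ regroup d y _ (toℕ j) ⟩
    y + (d + toℕ j + sumFin k xs)  ≡⟨ cong (y +_) block-sum ⟩
    y + (K * d + T)                ≡⟨ x∙yz≈y∙xz y (K * d) T ⟩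
    K * d + (y + T)                ≡⟨ cong (K * d +_) quotient ⟩
    K * d + (K * x + toℕ j)        ≡⟨ +-assoc (K * d) (K * x) (toℕ j) ⟨
    K * d + K * x + toℕ j          ≡⟨ cong (_+ toℕ j) (*-distribˡ-+ K d x) ⟨
    K * (d + x) + toℕ j            ∎)

division : ∀ k a → a ≡ suc k * (a / suc k) + toℕ (a mod suc k)
division k a = begin
  a                                    ≡⟨ m≡m%n+[m/n]*n a (suc k) ⟩
  a % suc k + a / suc k * suc k        ≡⟨ +-comm (a % suc k) _ ⟩
  a / suc k * suc k + a % suc k        ≡⟨ cong₂ _+_ (*-comm (a / suc k) (suc k)) (sym (toℕ-fromℕ< _)) ⟩
  suc k * (a / suc k) + toℕ (a mod suc k) ∎
  where open ≡-Reasoning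

twice-suc : ∀ m → 2 * suc m ≡ suc (2 * m + 1)
twice-suc = solve-∀

gauss-even : ∀ m → sumFin (suc (2 * m + 1)) toℕ ≡ suc m * (2 * m + 1)
gauss-even m = *-cancelˡ-≡ _ _ 2 (begin
  2 * sumFin (suc k) toℕ   ≡⟨ gauss k ⟩
  suc k * k                ≡⟨ cong (_* k) (twice-suc m) ⟨
  2 * suc m * k            ≡⟨ *-assoc 2 (suc m) k ⟩
  2 * (suc m * k)          ∎)
  where
  open ≡-Reasoning
  k = 2 * m + 1

quotient-bound : ∀ m y → 1 ≤ m → y < 4 * suc m →
  (y + sumFin (suc (2 * m + 1)) toℕ) / suc (2 * m + 1) < suc (2 * m + 1)
quotient-bound (suc m) y _ y<4n = m<n*o⇒m/o<n (begin-strict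
  y + T                                   <⟨ +-monoˡ-< T y<4n ⟩
  4 * n + T                               ≡⟨ cong (4 * n +_) (gauss-even (suc m)) ⟩
  4 * n + n * k                           ≤⟨ m≤m+n _ (n * (2 * m + 1)) ⟩
  4 * n + n * k + n * (2 * m + 1)         ≡⟨ square m ⟩
  suc k * suc k                           ∎)
  where
  open ≤-Reasoning
  n = suc (suc m)
  k = 2 * suc m + 1
  T = sumFin (suc k) toℕ
  square : ∀ m → 4 * (2 + m) + (2 + m) * (2 * (1 + m) + 1) + (2 + m) * (2 * m + 1)
               ≡ (1 + (2 * (1 + m) + 1)) * (1 + (2 * (1 + m) + 1))
  square = solve-∀

block-balanced : ∀ m (S : ℕ → Set) (d y : ℕ) → 1 ≤ m → y < 4 * suc m →
  (∀ t → t < 2 * suc m → S (d + t)) → Balanced (2 * m + 1) S (d + y)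
block-balanced m S d y 1≤m y<4n block =
  omission-balanced k S d y (a / suc k) (a mod suc k)
    (λ i → block (toℕ i) (in-block (toℕ<n i)))
    (block (a / suc k) (in-block (quotient-bound m y 1≤m y<4n)))
    (division k a)
  where
  k = 2 * m + 1
  a = y + sumFin (suc k) toℕ
  in-block : ∀ {t} → t < suc k → t < 2 * suc m
  in-block {t} = subst (t <_) (sym (twice-suc m))

balanced-statement : ∀ m (S : ℕ → Set) α → Balanced (2 * m + 1) S α →
  Σ (Fin (2 * m + 1) → ℕ) λ xs → Σ ℕ λ xlast →
    ((i : Fin (2 * m + 1)) → S (xs i)) × S xlast ×
    Injective _≡_ _≡_ xs ×
    (α + sumFin (2 * m + 1) xs ≡ 2 * suc m * xlast)
balanced-statement m S α (xs , xlast , xs∈S , xlast∈S , injective , sum) =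
  xs , xlast , xs∈S , xlast∈S , injective ,
  trans sum (cong (_* xlast) (sym (twice-suc m)))

<-by-gap : ∀ a c {b} → a + suc c ≡ b → a < b
<-by-gap a c gap = subst (a <_) gap (m<m+n a z<s)

N-below-4n : ∀ m y → 1 ≤ m → inN (suc m) y → y < 4 * suc m
N-below-4n m       y _ (inj₁ y<2n) = <-≤-trans y<2n (*-monoˡ-≤ (suc m) {2} {4} (s≤s (s≤s z≤n)))
N-below-4n (suc m) y _ (inj₂ refl) = <-by-gap _ (2 * m + 2) (gap m)
  where
  gap : ∀ m → 2 * (2 + m) + 1 + suc (2 * m + 2) ≡ 4 * (2 + m)
  gap = solve-∀

3n+1-below-4n : ∀ m → 1 ≤ m → 3 * suc m + 1 < 4 * suc m
3n+1-below-4n (suc m) _ = <-by-gap _ m (gap m)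
  where
  gap : ∀ m → 3 * (2 + m) + 1 + suc m ≡ 4 * (2 + m)
  gap = solve-∀

certified : ∀ {k} {L : List ℕ} α (xs : Vec ℕ k) (xlast : ℕ)
  {_ : True (all? λ i → lookup xs i ∈? L)} {_ : True (xlast ∈? L)}
  {_ : True (all? λ i → all? λ i′ → (lookup xs i ≟ lookup xs i′) →-dec (i Fin.≟ i′))} →
  α + sumFin k (lookup xs) ≡ suc k * xlast → Balanced k (_∈ L) α
certified α xs xlast {xs∈L} {xlast∈L} {distinct} sum =
  lookup xs , xlast , toWitness xs∈L , toWitness xlast∈L ,
  (λ {i} {i′} → toWitness distinct i i′) , sum

R₃ R₅ R₇ : List ℕ
R₃ = 0 ∷ []
R₅ = 0 ∷ 1 ∷ 2 ∷ 3 ∷ 5 ∷ 7 ∷ 13 ∷ 26 ∷ 27 ∷ 28 ∷ 29 ∷ 31 ∷ []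
R₇ = 0 ∷ 1 ∷ 2 ∷ 3 ∷ 4 ∷ 5 ∷ 7 ∷ 10 ∷ 33 ∷ 34 ∷ 35 ∷ 36 ∷ 37 ∷ 38 ∷ []

R₃-balanced : All (Balanced 1 (_∈ R₃)) R₃
R₃-balanced = certified  0 (0 ∷ᵥ []ᵥ) 0 refl ∷ []

R₅-balanced : All (Balanced 3 (_∈ R₅)) R₅
R₅-balanced =
  certified  0 (0 ∷ᵥ 1 ∷ᵥ 3 ∷ᵥ []ᵥ) 1 refl ∷
  certified  1 (0 ∷ᵥ 1 ∷ᵥ 2 ∷ᵥ []ᵥ) 1 refl ∷
  certified  2 (0 ∷ᵥ 1 ∷ᵥ 5 ∷ᵥ []ᵥ) 2 refl ∷
  certified  3 (0 ∷ᵥ 2 ∷ᵥ 3 ∷ᵥ []ᵥ) 2 refl ∷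
  certified  5 (0 ∷ᵥ 1 ∷ᵥ 2 ∷ᵥ []ᵥ) 2 refl ∷
  certified  7 (0 ∷ᵥ 2 ∷ᵥ 3 ∷ᵥ []ᵥ) 3 refl ∷
  certified 13 (0 ∷ᵥ 2 ∷ᵥ 5 ∷ᵥ []ᵥ) 5 refl ∷
  certified 26 (26 ∷ᵥ 27 ∷ᵥ 29 ∷ᵥ []ᵥ) 27 refl ∷
  certified 27 (5 ∷ᵥ 7 ∷ᵥ 13 ∷ᵥ []ᵥ) 13 refl ∷
  certified 28 (26 ∷ᵥ 27 ∷ᵥ 31 ∷ᵥ []ᵥ) 28 refl ∷
  certified 29 (3 ∷ᵥ 7 ∷ᵥ 13 ∷ᵥ []ᵥ) 13 refl ∷
  certified 31 (1 ∷ᵥ 7 ∷ᵥ 13 ∷ᵥ []ᵥ) 13 refl ∷ []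

R₇-balanced : All (Balanced 5 (_∈ R₇)) R₇
R₇-balanced =
  certified  0 (0 ∷ᵥ 1 ∷ᵥ 2 ∷ᵥ 3 ∷ᵥ 36 ∷ᵥ []ᵥ) 7 refl ∷
  certified  1 (0 ∷ᵥ 1 ∷ᵥ 2 ∷ᵥ 3 ∷ᵥ 5 ∷ᵥ []ᵥ) 2 refl ∷
  certified  2 (0 ∷ᵥ 1 ∷ᵥ 2 ∷ᵥ 3 ∷ᵥ 4 ∷ᵥ []ᵥ) 2 refl ∷
  certified  3 (0 ∷ᵥ 1 ∷ᵥ 2 ∷ᵥ 3 ∷ᵥ 33 ∷ᵥ []ᵥ) 7 refl ∷
  certified  4 (0 ∷ᵥ 1 ∷ᵥ 2 ∷ᵥ 4 ∷ᵥ 7 ∷ᵥ []ᵥ) 3 refl ∷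
  certified  5 (0 ∷ᵥ 1 ∷ᵥ 2 ∷ᵥ 3 ∷ᵥ 7 ∷ᵥ []ᵥ) 3 refl ∷
  certified  7 (0 ∷ᵥ 1 ∷ᵥ 2 ∷ᵥ 3 ∷ᵥ 5 ∷ᵥ []ᵥ) 3 refl ∷
  certified 10 (0 ∷ᵥ 1 ∷ᵥ 2 ∷ᵥ 4 ∷ᵥ 7 ∷ᵥ []ᵥ) 4 refl ∷
  certified 33 (1 ∷ᵥ 4 ∷ᵥ 5 ∷ᵥ 7 ∷ᵥ 10 ∷ᵥ []ᵥ) 10 refl ∷
  certified 34 (0 ∷ᵥ 4 ∷ᵥ 5 ∷ᵥ 7 ∷ᵥ 10 ∷ᵥ []ᵥ) 10 refl ∷
  certified 35 (0 ∷ᵥ 3 ∷ᵥ 5 ∷ᵥ 7 ∷ᵥ 10 ∷ᵥ []ᵥ) 10 refl ∷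
  certified 36 (0 ∷ᵥ 2 ∷ᵥ 5 ∷ᵥ 7 ∷ᵥ 10 ∷ᵥ []ᵥ) 10 refl ∷
  certified 37 (0 ∷ᵥ 1 ∷ᵥ 5 ∷ᵥ 7 ∷ᵥ 10 ∷ᵥ []ᵥ) 10 refl ∷
  certified 38 (0 ∷ᵥ 1 ∷ᵥ 4 ∷ᵥ 7 ∷ᵥ 10 ∷ᵥ []ᵥ) 10 refl ∷ []

R-large-balanced : ∀ m → let n = suc (suc (suc (suc m))) in
  ∀ α → R n α → Balanced (2 * (3 + m) + 1) (R n) α
R-large-balanced m α (inj₁ α∈N) =
  block-balanced (3 + m) _ 0 α (s≤s z≤n) (N-below-4n (3 + m) α (s≤s z≤n) α∈N) λ _ → inj₁ ∘ inj₁
R-large-balanced m α (inj₂ (inj₁ refl)) =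
  block-balanced (3 + m) _ 0 α (s≤s z≤n) (3n+1-below-4n (3 + m) (s≤s z≤n)) λ _ → inj₁ ∘ inj₁
R-large-balanced m α (inj₂ (inj₂ (y , y∈N , refl))) =
  subst (Balanced _ (R n)) (+-comm c y)
    (block-balanced (3 + m) _ c y (s≤s z≤n) (N-below-4n (3 + m) y (s≤s z≤n) y∈N) upper-block)
  where
  n = 4 + m
  c = 2 * n ^ 2 + 5 * n

  upper-block : ∀ t → t < 2 * n → R n (c + t)
  upper-block t t<2n = inj₂ (inj₂ (t , inj₁ t<2n , +-comm c t))

lemma12 : (m : ℕ) → let n = suc m in
    (α : ℕ) → R n α →
    Σ (Fin (2 * m + 1) → ℕ) λ xs → Σ ℕ λ xlast →
      ((i : Fin (2 * m + 1)) → R n (xs i)) × R n xlast ×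
      Injective _≡_ _≡_ xs ×
      (α + sumFin (2 * m + 1) xs ≡ 2 * n * xlast)
lemma12 m α α∈R = balanced-statement m (R (suc m)) α (balanced m α α∈R)
  where
  balanced : ∀ m α → R (suc m) α → Balanced (2 * m + 1) (R (suc m)) α
  balanced 0 α α∈R = All.lookup R₃-balanced α∈R
  balanced 1 α α∈R = All.lookup R₅-balanced α∈R
  balanced 2 α α∈R = All.lookup R₇-balanced α∈R
  balanced (suc (suc (suc m))) α α∈R = R-large-balanced m α α∈R
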